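{- Let $G$ be a $5$-odd-connected graph, let $v$ be a vertex of degree $d\ge 6$ and let $v_1,\ldots,v_d$ be its neighbors. Then at least one of the graphs $G.v_ivv_{i+1}$, $i=1,\ldots,5$, is also $5$-odd-connected.
   Context: Graphs may have loops and parallel edges. For a partition $(A,B)$ of the vertex set, the edge-cut $E(A,B)$ is the set of edges with one end in $A$ and the other in $B$. A graph is $5$-odd-connected if it has no edge-cut of odd size less than $5$. Splitting: for a vertex $v$ and neighbors $v_1,v_2$ of $v$, the graph $G.v_1vv_2$ is obtained by removing the edges $vv_1$ and $vv_2$ and adding a new vertex joined by one edge to $v_1$ and one edge to $v_2$ (with the natural conventions for loops: if $vv_1$ is a loop, the loop is removed and $vv_2$ is subdivided, and symmetrically; if both are loops, they are removed and a new vertex joined to $v$ by two parallel edges is added). -}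

module Defs where

open import Data.Nat using (ℕ; zero; suc; _≤_; _<_; _%_)
open import Data.Nat.Properties using (≤-trans)
open import Data.Fin using (Fin; zero; suc; toℕ; fromℕ; fromℕ<; inject₁; _≟_)
open import Data.Fin.Properties using (toℕ<n)
open import Data.Bool using (Bool; true; false; not; _∨_; _xor_; if_then_else_)
open import Data.List using (List; []; _∷_; length; lookup; map; filter; _++_)
open import Data.Product using (Σ; _×_; _,_; proj₁; proj₂)
open import Relation.Binary.PropositionalEquality using (_≡_)
open import Relation.Nullary.Decidable using (⌊_⌋)
open import Relation.Unary using (Decidable)

-- A finite multigraph (loops and parallel edges allowed):
-- vertices are Fin V, edges are the entries of the list E (an edge is
-- given by its two ends; a loop has equal ends; repeated entries are
-- parallel edges).
record Graph : Set where
  field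
    V : ℕ
    E : List (Fin V × Fin V)
open Graph public

Edge : Graph → Set
Edge G = Fin (length (E G))

endpoint : ∀ {n} → Fin n × Fin n → Bool → Fin n
endpoint (x , y) true  = x
endpoint (x , y) false = y

-- A half-edge (edge-end) at v: an edge together with one of its two sides
-- whose end is v.  A loop at v gives two half-edges, so the number of
-- half-edges at v is the degree of v.
HalfEdge : (G : Graph) → Fin (V G) → Set
HalfEdge G v = Σ (Edge G) λ e → Σ Bool λ s → endpoint (lookup (E G) e) s ≡ v

edgeOf : ∀ G {v} → HalfEdge G v → Edge G
edgeOf G (e , _ , _) = e

nbr : ∀ G {v} → HalfEdge G v → Fin (V G)
nbr G (e , s , _) = endpoint (lookup (E G) e) (not s)

dropWhere : ∀ {A : Set} (xs : List A) → (Fin (length xs) → Bool) → List A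
dropWhere [] p = []
dropWhere (x ∷ xs) p with p zero
... | true  = dropWhere xs (λ k → p (suc k))
... | false = x ∷ dropWhere xs (λ k → p (suc k))

-- Splitting G.v₁vv₂ along two distinct half-edges a, b at v (with ends
-- v₁ = nbr G a, v₂ = nbr G b): remove the edges of a and b, add a new vertex
-- (the last vertex, fromℕ (V G)) joined by one edge to v₁ and one to v₂.
split : (G : Graph) (v : Fin (V G)) → HalfEdge G v → HalfEdge G v → Graph
split G v a b = record
  { V = suc (V G)
  ; E = map (λ { (x , y) → inject₁ x , inject₁ y })
            (dropWhere (E G) (λ k → ⌊ k ≟ edgeOf G a ⌋ ∨ ⌊ k ≟ edgeOf G b ⌋))
        ++ ((w , inject₁ (nbr G a)) ∷ (w , inject₁ (nbr G b)) ∷ [])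
  }
  where
  w : Fin (suc (V G))
  w = fromℕ (V G)

cutSize : (G : Graph) → (Fin (V G) → Bool) → ℕ
cutSize G A = length (filter (λ xy → crosses xy) (E G))
  where
  open import Relation.Nullary.Decidable using (Dec; yes; no)
  open import Data.Bool using (T)
  open import Data.Bool.Properties using (T?)
  crosses : Decidable (λ (xy : Fin (V G) × Fin (V G)) → T (A (proj₁ xy) xor A (proj₂ xy)))
  crosses xy = T? _

FiveOddConnected : Graph → Set
FiveOddConnected G = ∀ (A : Fin (V G) → Bool) →
  cutSize G A % 2 ≡ 1 → 5 ≤ cutSize G A

idx : ∀ {d} → 6 ≤ d → Fin 6 → Fin d
idx p j = fromℕ< (≤-trans (toℕ<n j) p)

module Submission where

open import Defs
open import Data.Nat using (ℕ; _≤_)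
open import Data.Fin using (Fin; suc; inject₁)
open import Data.Product using (∃)
open import Function.Bundles using (_⤖_; Bijection)

open import Data.Nat using (zero; suc; _+_; _<_; z≤n; s≤s; _%_; _<?_)
import Data.Nat as ℕ
open import Data.Nat.Properties
  using (+-0-commutativeMonoid; +-commutativeSemigroup; +-assoc; +-identityʳ;
         ≤-refl; ≤-trans; ≤-reflexive; ≤-antisym; m≤m+n; m≤n+m; +-comm; +-mono-≤; +-monoʳ-≤; +-cancelʳ-≤;
         <-irrefl; ≮⇒≥; 1+n≢n)
open import Data.Fin using (zero; toℕ; fromℕ; _≟_)
open import Data.Fin.Properties using (toℕ-injective; toℕ-inject₁; fromℕ<-injective; suc-injective; 0≢1+n)
open import Data.Fin.Subset.Properties using (anySubset?)
open import Data.Vec using (tabulate) renaming (lookup to lookupᵥ)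
open import Data.Vec.Properties using (lookup∘tabulate)
open import Data.Vec.Functional using (updateAt)
open import Data.Vec.Functional.Properties using (updateAt-updates; updateAt-minimal)
open import Data.Bool using (Bool; true; false; not; _∧_; _∨_; _xor_; if_then_else_)
open import Data.Bool.Properties
  using (T?; xor-same; xor-comm; xor-identityʳ; not-injective; not-distribˡ-xor; ∨-zeroʳ; ∧-zeroʳ;
         xor-∧-commutativeRing; not-involutive)
open import Data.List using (List; []; _∷_; length; lookup; map; filter; _++_)
open import Data.List.Properties using (length-++; filter-++)
open import Data.Product using (Σ; _×_; _,_; proj₁; proj₂)
open import Data.Sum using (_⊎_; inj₁; inj₂)
open import Data.Empty using (⊥; ⊥-elim)
open import Function using (_∘_)
open import Function.Definitions using (Injective)
open import Relation.Binary.PropositionalEquality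
open import Relation.Nullary using (yes; no; _×-dec_)
open import Relation.Nullary.Decidable using (⌊_⌋)
open import Algebra.Bundles using (CommutativeRing)
open import Algebra.Properties.CommutativeMonoid.Sum +-0-commutativeMonoid
  using (sum; ∑-distrib-+; sum-cong-≗)
import Algebra.Properties.CommutativeSemigroup as CommSemigroupProperties
open import Axiom.UniquenessOfIdentityProofs using (module Decidable⇒UIP)

-- Let a₀, …, a₅ be six distinct half-edges at v with other ends u₀, …, u₅.
-- (1) Splitting lemma: if G.uᵢvuⱼ is not 5-odd-connected, a small odd cut of the split
--     graph, restricted to G, is a 5-cut of G separating v from uᵢ and uⱼ (the new
--     vertex only moves two edge-ends, which changes the cut by an even amount ≤ 2).
--     Taking its side containing v gives an obstruction: a 5-cut around v avoiding uᵢ, uⱼ.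
-- (2) Uncrossing: two 5-cuts around v avoiding a common neighbour uⱼ intersect in a
--     5-cut around v; this follows from the submodular and posimodular identities for
--     cuts together with the additivity of cut parities.
-- (3) If all five splittings at uᵢ, uᵢ₊₁ failed, iterating (2) along the chain of
--     obstructions gives a 5-cut around v avoiding all of u₀, …, u₅; but the six
--     distinct edges of a₀, …, a₅ all cross it, a contradiction.  Since the graph is finite,
-- 5-odd-connectivity is decided by exhaustive search, which makes the argument constructive.

𝟙 : Bool → ℕ
𝟙 true  = 1
𝟙 false = 0

Odd : ℕ → Set
Odd n = n % 2 ≡ 1

open CommSemigroupProperties +-commutativeSemigroup using (x∙yz≈y∙xz)
open CommSemigroupProperties (CommutativeRing.+-commutativeSemigroup xor-∧-commutativeRing)
  using () renaming (interchange to xor-interchange)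

parity : ℕ → Bool
parity zero    = false
parity (suc n) = not (parity n)

parity-+ : ∀ m n → parity (m + n) ≡ parity m xor parity n
parity-+ zero    n = refl
parity-+ (suc m) n = trans (cong not (parity-+ m n)) (not-distribˡ-xor (parity m) (parity n))

parity-double : ∀ n → parity (n + n) ≡ false
parity-double n = trans (parity-+ n n) (xor-same (parity n))

parity-𝟙 : ∀ b → parity (𝟙 b) ≡ b
parity-𝟙 true  = refl
parity-𝟙 false = refl

odd⇒parity : ∀ n → Odd n → parity n ≡ true
odd⇒parity 0             ()
odd⇒parity 1             _ = refl
odd⇒parity (suc (suc n)) o = trans (not-involutive (parity n)) (odd⇒parity n o)

parity⇒odd : ∀ n → parity n ≡ true → Odd n
parity⇒odd 0             ()
parity⇒odd 1             _ = refl
parity⇒odd (suc (suc n)) p = parity⇒odd n (trans (sym (not-involutive (parity n))) p)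

xor-cancelˡ : ∀ x {y z} → x xor y ≡ x xor z → y ≡ z
xor-cancelˡ false eq = eq
xor-cancelˡ true  eq = not-injective eq

same-parity : ∀ m n k c → m + n + (k + k) ≡ c + c → parity m ≡ parity n
same-parity m n k c eq = xor-cancelˡ (parity m) (begin
    parity m xor parity m              ≡⟨ xor-same (parity m) ⟩
    false                              ≡⟨ sym (parity-double c) ⟩
    parity (c + c)                     ≡⟨ cong parity (sym eq) ⟩
    parity (m + n + (k + k))           ≡⟨ parity-+ (m + n) (k + k) ⟩
    parity (m + n) xor parity (k + k)  ≡⟨ cong₂ _xor_ (parity-+ m n) (parity-double k) ⟩
    (parity m xor parity n) xor false  ≡⟨ xor-identityʳ _ ⟩
    parity m xor parity n              ∎)
  where open ≡-Reasoning

squeeze : ∀ {m n k c} → c ≤ m → c ≤ n → m + n + (k + k) ≡ c + c → m ≡ c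
squeeze {m} {n} {k} {c} c≤m c≤n eq = ≤-antisym m≤c c≤m
  where
  m≤c : m ≤ c
  m≤c = +-cancelʳ-≤ n m c
          (≤-trans (≤-trans (m≤m+n (m + n) (k + k)) (≤-reflexive eq)) (+-monoʳ-≤ c c≤n))

overfull : ∀ {m n k c} → c ≤ m → c ≤ n → 1 ≤ k → m + n + (k + k) ≡ c + c → ⊥
overfull {k = k} {c} c≤m c≤n 1≤k eq = <-irrefl refl (subst (_≤ c + c) (+-comm (c + c) 1) c+c+1≤c+c)
  where
  c+c+1≤c+c : c + c + 1 ≤ c + c
  c+c+1≤c+c = ≤-trans (+-mono-≤ (+-mono-≤ c≤m c≤n) (≤-trans 1≤k (m≤m+n k k))) (≤-reflexive eq)

odd-below-5 : ∀ {c} → Odd c → c < 5 → c ≤ 3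
odd-below-5 {0} ()
odd-below-5 {1} _ _ = s≤s z≤n
odd-below-5 {2} ()
odd-below-5 {3} _ _ = ≤-refl
odd-below-5 {4} ()
odd-below-5 {suc (suc (suc (suc (suc c))))} _ (s≤s (s≤s (s≤s (s≤s (s≤s ())))))

zeroAt : ∀ {n} → (Fin n → ℕ) → Fin n → Fin n → ℕ
zeroAt f e = updateAt f e (λ _ → 0)

sum-zeroAt : ∀ {n} (f : Fin n → ℕ) e → sum f ≡ f e + sum (zeroAt f e)
sum-zeroAt f zero    = refl
sum-zeroAt f (suc e) =
  trans (cong (f zero +_) (sum-zeroAt (f ∘ suc) e)) (x∙yz≈y∙xz (f zero) (f (suc e)) _)

term≤sum : ∀ {n} (f : Fin n → ℕ) e → f e ≤ sum f
term≤sum f e = subst (f e ≤_) (sym (sum-zeroAt f e)) (m≤m+n (f e) _)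

sum-≥-injective : ∀ {m n} (f : Fin n → ℕ) (e : Fin m → Fin n) → Injective _≡_ _≡_ e →
  (∀ i → 1 ≤ f (e i)) → m ≤ sum f
sum-≥-injective {zero}  f e e-inj pos = z≤n
sum-≥-injective {suc m} f e e-inj pos =
  subst (suc m ≤_) (sym (sum-zeroAt f (e zero)))
    (+-mono-≤ (pos zero)
      (sum-≥-injective (zeroAt f (e zero)) (e ∘ suc) (λ eq → suc-injective (e-inj eq)) pos′))
  where
  pos′ : ∀ i → 1 ≤ zeroAt f (e zero) (e (suc i))
  pos′ i = subst (1 ≤_)
    (sym (updateAt-minimal (e (suc i)) (e zero) f (λ eq → 0≢1+n (sym (e-inj eq)))))
    (pos (suc i))

drop-two : ∀ {n} (f : Fin n → ℕ) e₁ e₂ k →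
  (if ⌊ k ≟ e₁ ⌋ ∨ ⌊ k ≟ e₂ ⌋ then 0 else f k) ≡ zeroAt (zeroAt f e₁) e₂ k
drop-two f e₁ e₂ k with k ≟ e₁ | k ≟ e₂
... | yes refl | yes refl = sym (updateAt-updates k (zeroAt f k))
... | no  _    | yes refl = sym (updateAt-updates k (zeroAt f e₁))
... | yes refl | no k≢e₂  = sym (trans (updateAt-minimal k e₂ (zeroAt f k) k≢e₂) (updateAt-updates k f))
... | no k≢e₁  | no k≢e₂  =
  sym (trans (updateAt-minimal k e₂ (zeroAt f e₁) k≢e₂) (updateAt-minimal k e₁ f k≢e₁))

count : ∀ {X : Set} → (X → Bool) → List X → ℕ
count g xs = length (filter (λ x → T? (g x)) xs)

count-as-sum : ∀ {X : Set} (g : X → Bool) xs → count g xs ≡ sum (λ k → 𝟙 (g (lookup xs k)))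
count-as-sum g []       = refl
count-as-sum g (x ∷ xs) with g x
... | true  = cong suc (count-as-sum g xs)
... | false = count-as-sum g xs

count-++ : ∀ {X : Set} (g : X → Bool) xs ys → count g (xs ++ ys) ≡ count g xs + count g ys
count-++ g xs ys =
  trans (cong length (filter-++ (λ x → T? (g x)) xs ys)) (length-++ (filter (λ x → T? (g x)) xs))

count-map : ∀ {X Y : Set} (g : Y → Bool) (f : X → Y) xs → count g (map f xs) ≡ count (g ∘ f) xs
count-map g f []       = refl
count-map g f (x ∷ xs) with g (f x)
... | true  = cong suc (count-map g f xs)
... | false = count-map g f xs

count-dropWhere : ∀ {X : Set} (g : X → Bool) xs (p : Fin (length xs) → Bool) →
  count g (dropWhere xs p) ≡ sum (λ k → if p k then 0 else 𝟙 (g (lookup xs k)))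
count-dropWhere g []       p = refl
count-dropWhere g (x ∷ xs) p with p zero
... | true  = count-dropWhere g xs (p ∘ suc)
... | false with g x
...   | true  = cong suc (count-dropWhere g xs (p ∘ suc))
...   | false = count-dropWhere g xs (p ∘ suc)

_∩_ _∪_ _∖_ _⊕_ : ∀ {n} → (Fin n → Bool) → (Fin n → Bool) → Fin n → Bool
(X ∩ Y) z = X z ∧ Y z
(X ∪ Y) z = X z ∨ Y z
(X ∖ Y) z = X z ∧ not (Y z)
(X ⊕ Y) z = X z xor Y z

∁ : ∀ {n} → (Fin n → Bool) → Fin n → Bool
∁ X z = not (X z)

crosses : ∀ {n} → (Fin n → Bool) → Fin n × Fin n → Bool
crosses A xy = A (proj₁ xy) xor A (proj₂ xy)

between : ∀ {n} → (Fin n → Bool) → (Fin n → Bool) → Fin n × Fin n → Bool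
between S T xy = (S (proj₁ xy) ∧ T (proj₂ xy)) ∨ (T (proj₁ xy) ∧ S (proj₂ xy))

edgeCount : (G : Graph) → (Fin (V G) × Fin (V G) → Bool) → ℕ
edgeCount G F = sum (λ k → 𝟙 (F (lookup (E G) k)))

boundary : (G : Graph) → (Fin (V G) → Bool) → Edge G → ℕ
boundary G A k = 𝟙 (crosses A (lookup (E G) k))

cut-as-sum : ∀ G A → cutSize G A ≡ sum (boundary G A)
cut-as-sum G A = count-as-sum (crosses A) (E G)

cut-cong : ∀ G {A B} → (∀ x → A x ≡ B x) → cutSize G A ≡ cutSize G B
cut-cong G {A} {B} A≗B = begin
  cutSize G A        ≡⟨ cut-as-sum G A ⟩
  sum (boundary G A) ≡⟨ sum-cong-≗ (λ k → cong 𝟙 (crosses-at (lookup (E G) k))) ⟩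
  sum (boundary G B) ≡⟨ sym (cut-as-sum G B) ⟩
  cutSize G B        ∎
  where
  open ≡-Reasoning
  crosses-at : ∀ xy → crosses A xy ≡ crosses B xy
  crosses-at (x , y) = cong₂ _xor_ (A≗B x) (A≗B y)

cut-flip : ∀ G c A → cutSize G (λ z → c xor A z) ≡ cutSize G A
cut-flip G c A = trans (cut-as-sum G (λ z → c xor A z))
  (trans (sum-cong-≗ (λ k → cong 𝟙 (flip-at (lookup (E G) k)))) (sym (cut-as-sum G A)))
  where
  flip-at : ∀ xy → crosses (λ z → c xor A z) xy ≡ crosses A xy
  flip-at (x , y) = trans (xor-interchange c (A x) c (A y)) (cong (_xor (A x xor A y)) (xor-same c))

parity-sum-xor : ∀ {n} (f g : Fin n → Bool) →
  parity (sum (λ k → 𝟙 (f k xor g k))) ≡ parity (sum (𝟙 ∘ f)) xor parity (sum (𝟙 ∘ g))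
parity-sum-xor {zero}  f g = refl
parity-sum-xor {suc n} f g = begin
    parity (𝟙 (f zero xor g zero) + sum (λ k → 𝟙 (f (suc k) xor g (suc k))))
  ≡⟨ parity-+ (𝟙 (f zero xor g zero)) (sum (λ k → 𝟙 (f (suc k) xor g (suc k)))) ⟩
    parity (𝟙 (f zero xor g zero)) xor parity (sum (λ k → 𝟙 (f (suc k) xor g (suc k))))
  ≡⟨ cong₂ _xor_ (parity-𝟙 (f zero xor g zero)) (parity-sum-xor (f ∘ suc) (g ∘ suc)) ⟩
    (f zero xor g zero) xor (pf xor pg)
  ≡⟨ xor-interchange (f zero) (g zero) pf pg ⟩
    (f zero xor pf) xor (g zero xor pg)
  ≡⟨ sym (cong₂ _xor_ (head-parity f) (head-parity g)) ⟩
    parity (sum (𝟙 ∘ f)) xor parity (sum (𝟙 ∘ g))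
  ∎
  where
  open ≡-Reasoning
  pf = parity (sum (𝟙 ∘ f ∘ suc))
  pg = parity (sum (𝟙 ∘ g ∘ suc))
  head-parity : ∀ (h : Fin (suc n) → Bool) →
    parity (sum (𝟙 ∘ h)) ≡ h zero xor parity (sum (𝟙 ∘ h ∘ suc))
  head-parity h = trans (parity-+ (𝟙 (h zero)) (sum (𝟙 ∘ h ∘ suc)))
                        (cong (_xor parity (sum (𝟙 ∘ h ∘ suc))) (parity-𝟙 (h zero)))

cut-parity : ∀ G A B → parity (cutSize G (A ⊕ B)) ≡ parity (cutSize G A) xor parity (cutSize G B)
cut-parity G A B = begin
    parity (cutSize G (A ⊕ B))
  ≡⟨ cong parity (trans (cut-as-sum G (A ⊕ B)) (sum-cong-≗ (λ k → cong 𝟙 (interchange-at (lookup (E G) k))))) ⟩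
    parity (sum (λ k → 𝟙 (crosses A (lookup (E G) k) xor crosses B (lookup (E G) k))))
  ≡⟨ parity-sum-xor (λ k → crosses A (lookup (E G) k)) (λ k → crosses B (lookup (E G) k)) ⟩
    parity (sum (boundary G A)) xor parity (sum (boundary G B))
  ≡⟨ sym (cong₂ (λ m n → parity m xor parity n) (cut-as-sum G A) (cut-as-sum G B)) ⟩
    parity (cutSize G A) xor parity (cutSize G B)
  ∎
  where
  open ≡-Reasoning
  interchange-at : ∀ xy → crosses (A ⊕ B) xy ≡ crosses A xy xor crosses B xy
  interchange-at (x , y) = xor-interchange (A x) (B x) (A y) (B y)

boundary-halfEdge : ∀ G {v} A (a : HalfEdge G v) → boundary G A (edgeOf G a) ≡ 𝟙 (A v xor A (nbr G a))
boundary-halfEdge G A (e , true  , refl) = refl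
boundary-halfEdge G A (e , false , refl) =
  cong 𝟙 (xor-comm (A (proj₁ (lookup (E G) e))) (A (proj₂ (lookup (E G) e))))

between-halfEdge : ∀ G {v} (S T : Fin (V G) → Bool) (a : HalfEdge G v) →
  S v ≡ true → T (nbr G a) ≡ true → between S T (lookup (E G) (edgeOf G a)) ≡ true
between-halfEdge G S T (e , true  , refl) Sv Tu rewrite Sv | Tu = refl
between-halfEdge G S T (e , false , refl) Sv Tu rewrite Sv | Tu = ∨-zeroʳ _

same-edge : ∀ G {v} (a b : HalfEdge G v) → edgeOf G a ≡ edgeOf G b → a ≡ b ⊎ nbr G a ≡ v
same-edge G (e , true  , p) (.e , true  , q) refl = inj₁ (cong (λ r → e , true , r) (≡-irrelevant p q))
  where open Decidable⇒UIP _≟_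
same-edge G (e , false , p) (.e , false , q) refl = inj₁ (cong (λ r → e , false , r) (≡-irrelevant p q))
  where open Decidable⇒UIP _≟_
same-edge G (e , true  , p) (.e , false , q) refl = inj₂ q
same-edge G (e , false , p) (.e , true  , q) refl = inj₂ q

crossings₂ : Bool → Bool → Bool → ℕ
crossings₂ p q s = 𝟙 (p xor q) + 𝟙 (p xor s)

crossings₂≤2 : ∀ p q s → crossings₂ p q s ≤ 2
crossings₂≤2 p q s = +-mono-≤ (𝟙≤1 (p xor q)) (𝟙≤1 (p xor s))
  where
  𝟙≤1 : ∀ b → 𝟙 b ≤ 1
  𝟙≤1 true  = ≤-refl
  𝟙≤1 false = z≤n

crossings₂≡2 : ∀ p q s → crossings₂ p q s ≡ 2 → p xor q ≡ true × p xor s ≡ true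
crossings₂≡2 p q s with p xor q | p xor s
... | true  | true  = λ _ → refl , refl
... | true  | false = λ ()
... | false | true  = λ ()
... | false | false = λ ()

crossings₂-parity : ∀ p q s → parity (crossings₂ p q s) ≡ q xor s
crossings₂-parity true  true  true  = refl
crossings₂-parity true  true  false = refl
crossings₂-parity true  false true  = refl
crossings₂-parity true  false false = refl
crossings₂-parity false true  true  = refl
crossings₂-parity false true  false = refl
crossings₂-parity false false true  = refl
crossings₂-parity false false false = refl

-- Comparing a partition A′ of G.v₁vv₂ with its restriction A to G: the edges vv₁, vv₂
-- of G are replaced by wv₁, wv₂, where w is the new vertex; all other edges agree.
cut-split : ∀ G v (a b : HalfEdge G v) → a ≢ b → (A′ : Fin (suc (V G)) → Bool) →
  crossings₂ (A′ (inject₁ v)) (A′ (inject₁ (nbr G a))) (A′ (inject₁ (nbr G b)))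
    + cutSize (split G v a b) A′
  ≡ crossings₂ (A′ (fromℕ (V G))) (A′ (inject₁ (nbr G a))) (A′ (inject₁ (nbr G b)))
    + cutSize G (λ x → A′ (inject₁ x))
cut-split G v a b a≢b A′ = begin
    R + cutSize (split G v a b) A′ ≡⟨ cong (R +_) new-cut ⟩
    R + (S + R′)                   ≡⟨ sym (+-assoc R S R′) ⟩
    (R + S) + R′                   ≡⟨ +-comm (R + S) R′ ⟩
    R′ + (R + S)                   ≡⟨ cong (R′ +_) (sym old-cut) ⟩
    R′ + cutSize G A               ∎
  where
  open ≡-Reasoning
  A : Fin (V G) → Bool
  A x = A′ (inject₁ x)
  t  = A′ (fromℕ (V G))
  u₁ = nbr G a
  u₂ = nbr G b
  R  = crossings₂ (A v) (A u₁) (A u₂)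
  R′ = crossings₂ t (A u₁) (A u₂)
  w  = boundary G A
  ea = edgeOf G a
  eb = edgeOf G b
  S  = sum (zeroAt (zeroAt w ea) eb)
  dropped : Edge G → Bool
  dropped k = ⌊ k ≟ ea ⌋ ∨ ⌊ k ≟ eb ⌋

  -- the removed edges contribute R; if ea = eb, then a, b are the two ends of a loop
  removed : w ea + zeroAt w ea eb ≡ R
  removed with eb ≟ ea
  ... | no eb≢ea = cong₂ _+_ (boundary-halfEdge G A a)
                             (trans (updateAt-minimal eb ea w eb≢ea) (boundary-halfEdge G A b))
  ... | yes eb≡ea = cong₂ _+_ (boundary-halfEdge G A a)
                              (trans (cong (zeroAt w ea) eb≡ea) (trans (updateAt-updates ea w) (sym loop)))
    where
    loop : 𝟙 (A v xor A u₂) ≡ 0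
    loop with same-edge G b a eb≡ea
    ... | inj₁ b≡a  = ⊥-elim (a≢b (sym b≡a))
    ... | inj₂ u₂≡v = cong 𝟙 (trans (cong (λ z → A v xor A z) u₂≡v) (xor-same (A v)))

  old-cut : cutSize G A ≡ R + S
  old-cut = begin
    cutSize G A                     ≡⟨ cut-as-sum G A ⟩
    sum w                           ≡⟨ sum-zeroAt w ea ⟩
    w ea + sum (zeroAt w ea)        ≡⟨ cong (w ea +_) (sum-zeroAt (zeroAt w ea) eb) ⟩
    w ea + (zeroAt w ea eb + S)     ≡⟨ sym (+-assoc (w ea) _ S) ⟩
    (w ea + zeroAt w ea eb) + S     ≡⟨ cong (_+ S) removed ⟩
    R + S                           ∎

  lift : Fin (V G) × Fin (V G) → Fin (suc (V G)) × Fin (suc (V G))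
  lift z = inject₁ (proj₁ z) , inject₁ (proj₂ z)
  new-edges : List (Fin (suc (V G)) × Fin (suc (V G)))
  new-edges = (fromℕ (V G) , inject₁ u₁) ∷ (fromℕ (V G) , inject₁ u₂) ∷ []

  new-cut : cutSize (split G v a b) A′ ≡ S + R′
  new-cut = begin
      cutSize (split G v a b) A′
    ≡⟨ count-++ (crosses A′) (map lift (dropWhere (E G) dropped)) new-edges ⟩
      count (crosses A′) (map lift (dropWhere (E G) dropped)) + count (crosses A′) new-edges
    ≡⟨ cong₂ _+_ (count-map (crosses A′) lift (dropWhere (E G) dropped)) (count-as-sum (crosses A′) new-edges) ⟩
      count (crosses A) (dropWhere (E G) dropped) + (𝟙 (t xor A u₁) + (𝟙 (t xor A u₂) + 0))
    ≡⟨ cong₂ _+_ (count-dropWhere (crosses A) (E G) dropped) (cong (𝟙 (t xor A u₁) +_) (+-identityʳ _)) ⟩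
      sum (λ k → if dropped k then 0 else w k) + R′
    ≡⟨ cong (_+ R′) (sum-cong-≗ (drop-two w ea eb)) ⟩
      S + R′
    ∎

small-odd-cut-lifts : ∀ p q s t {c c′} → crossings₂ p q s + c′ ≡ crossings₂ t q s + c →
  Odd c′ → c′ < 5 → (Odd c → 5 ≤ c) → (p xor q ≡ true × p xor s ≡ true) × c ≡ 5
small-odd-cut-lifts p q s t {c} {c′} eq odd′ small bound = crossings₂≡2 p q s R≡2 , c≡5
  where
  open ≡-Reasoning
  R  = crossings₂ p q s
  R′ = crossings₂ t q s
  c′≤3 : c′ ≤ 3
  c′≤3 = odd-below-5 odd′ small
  same : parity c′ ≡ parity c
  same = xor-cancelˡ (q xor s) (begin
    (q xor s) xor parity c′   ≡⟨ cong (_xor parity c′) (sym (crossings₂-parity p q s)) ⟩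
    parity R xor parity c′    ≡⟨ sym (parity-+ R c′) ⟩
    parity (R + c′)           ≡⟨ cong parity eq ⟩
    parity (R′ + c)           ≡⟨ parity-+ R′ c ⟩
    parity R′ xor parity c    ≡⟨ cong (_xor parity c) (crossings₂-parity t q s) ⟩
    (q xor s) xor parity c    ∎)
  5≤c : 5 ≤ c
  5≤c = bound (parity⇒odd c (trans (sym same) (odd⇒parity c′ odd′)))
  c≤R+c′ : c ≤ R + c′
  c≤R+c′ = ≤-trans (m≤n+m c R′) (≤-reflexive (sym eq))
  c≡5 : c ≡ 5
  c≡5 = ≤-antisym (≤-trans c≤R+c′ (+-mono-≤ (crossings₂≤2 p q s) c′≤3)) 5≤c
  R≡2 : R ≡ 2
  R≡2 = ≤-antisym (crossings₂≤2 p q s)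
          (+-cancelʳ-≤ 3 2 R (≤-trans (≤-trans 5≤c c≤R+c′) (+-monoʳ-≤ R c′≤3)))

Tight : (G : Graph) → Fin (V G) → (Fin (V G) → Bool) → Set
Tight G v X = X v ≡ true × cutSize G X ≡ 5

Obstruction : (G : Graph) → Fin (V G) → Fin (V G) → Fin (V G) → Set
Obstruction G v u₁ u₂ = Σ (Fin (V G) → Bool) λ X → Tight G v X × X u₁ ≡ false × X u₂ ≡ false

separating-cut⇒obstruction : ∀ G {v u₁ u₂} A → A v xor A u₁ ≡ true → A v xor A u₂ ≡ true →
  cutSize G A ≡ 5 → Obstruction G v u₁ u₂
separating-cut⇒obstruction G {v} A h₁ h₂ c≡5 =
  side-of-v , (contains-v , trans (cut-flip G (not (A v)) A) c≡5) , avoids h₁ , avoids h₂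
  where
  side-of-v : Fin (V G) → Bool
  side-of-v z = not (A v) xor A z
  contains-v : side-of-v v ≡ true
  contains-v = trans (sym (not-distribˡ-xor (A v) (A v))) (cong not (xor-same (A v)))
  avoids : ∀ {u} → A v xor A u ≡ true → side-of-v u ≡ false
  avoids {u} h = trans (sym (not-distribˡ-xor (A v) (A u))) (cong not h)

odd-connected-or-small-odd-cut : ∀ G →
  FiveOddConnected G ⊎ Σ (Fin (V G) → Bool) (λ A → Odd (cutSize G A) × cutSize G A < 5)
odd-connected-or-small-odd-cut G with anySubset? {P = λ S → SmallOddCut (lookupᵥ S)}
                                       (λ S → (cutSize G (lookupᵥ S) % 2 ℕ.≟ 1) ×-dec (cutSize G (lookupᵥ S) <? 5))
  where
  SmallOddCut : (Fin (V G) → Bool) → Set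
  SmallOddCut A = Odd (cutSize G A) × cutSize G A < 5
... | yes (S , small-odd-cut) = inj₂ (lookupᵥ S , small-odd-cut)
... | no none = inj₁ λ A odd → ≮⇒≥ λ small →
  let same-cut = cut-cong G (lookup∘tabulate A)
  in none (tabulate A , subst Odd (sym same-cut) odd , subst (_< 5) (sym same-cut) small)

split-or-obstruction : ∀ G → FiveOddConnected G → ∀ v (a b : HalfEdge G v) → a ≢ b →
  FiveOddConnected (split G v a b) ⊎ Obstruction G v (nbr G a) (nbr G b)
split-or-obstruction G oc v a b a≢b with odd-connected-or-small-odd-cut (split G v a b)
... | inj₁ split-ok = inj₁ split-ok
... | inj₂ (A′ , odd , small) =
  let A = λ x → A′ (inject₁ x)
      ((h₁ , h₂) , c≡5) = small-odd-cut-lifts (A v) (A (nbr G a)) (A (nbr G b)) (A′ (fromℕ (V G)))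
                            (cut-split G v a b a≢b A′) odd small (oc A)
  in inj₂ (separating-cut⇒obstruction G A h₁ h₂ c≡5)

uncross-edge : ∀ {n} (X Y : Fin n → Bool) (xy : Fin n × Fin n) →
  (𝟙 (crosses (X ∩ Y) xy) + 𝟙 (crosses (X ∪ Y) xy)
     + (𝟙 (between (X ∖ Y) (Y ∖ X) xy) + 𝟙 (between (X ∖ Y) (Y ∖ X) xy))
   ≡ 𝟙 (crosses X xy) + 𝟙 (crosses Y xy)) ×
  (𝟙 (crosses (X ∖ Y) xy) + 𝟙 (crosses (Y ∖ X) xy)
     + (𝟙 (between (X ∩ Y) (∁ (X ∪ Y)) xy) + 𝟙 (between (X ∩ Y) (∁ (X ∪ Y)) xy))
   ≡ 𝟙 (crosses X xy) + 𝟙 (crosses Y xy))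
uncross-edge X Y (x , y) with X x | Y x | X y | Y y
... | true  | true  | true  | true  = refl , refl
... | true  | true  | true  | false = refl , refl
... | true  | true  | false | true  = refl , refl
... | true  | true  | false | false = refl , refl
... | true  | false | true  | true  = refl , refl
... | true  | false | true  | false = refl , refl
... | true  | false | false | true  = refl , refl
... | true  | false | false | false = refl , refl
... | false | true  | true  | true  = refl , refl
... | false | true  | true  | false = refl , refl
... | false | true  | false | true  = refl , refl
... | false | true  | false | false = refl , refl
... | false | false | true  | true  = refl , refl
... | false | false | true  | false = refl , refl
... | false | false | false | true  = refl , refl
... | false | false | false | false = refl , refl

cuts-identity : ∀ G (A B C D : Fin (V G) → Bool) F →
  (∀ xy → 𝟙 (crosses A xy) + 𝟙 (crosses B xy) + (𝟙 (F xy) + 𝟙 (F xy)) ≡ 𝟙 (crosses C xy) + 𝟙 (crosses D xy)) →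
  cutSize G A + cutSize G B + (edgeCount G F + edgeCount G F) ≡ cutSize G C + cutSize G D
cuts-identity G A B C D F edgewise = begin
    cutSize G A + cutSize G B + (edgeCount G F + edgeCount G F)
  ≡⟨ cong₂ (λ m n → m + n + (edgeCount G F + edgeCount G F)) (cut-as-sum G A) (cut-as-sum G B) ⟩
    sum a + sum b + (sum f + sum f)
  ≡⟨ cong₂ _+_ (sym (∑-distrib-+ a b)) (sym (∑-distrib-+ f f)) ⟩
    sum (λ k → a k + b k) + sum (λ k → f k + f k)
  ≡⟨ sym (∑-distrib-+ (λ k → a k + b k) (λ k → f k + f k)) ⟩
    sum (λ k → a k + b k + (f k + f k))
  ≡⟨ sum-cong-≗ (λ k → edgewise (lookup (E G) k)) ⟩
    sum (λ k → c k + d k)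
  ≡⟨ ∑-distrib-+ c d ⟩
    sum c + sum d
  ≡⟨ sym (cong₂ _+_ (cut-as-sum G C) (cut-as-sum G D)) ⟩
    cutSize G C + cutSize G D
  ∎
  where
  open ≡-Reasoning
  a = boundary G A
  b = boundary G B
  c = boundary G C
  d = boundary G D
  f : Edge G → ℕ
  f k = 𝟙 (F (lookup (E G) k))

cut-∩-∪ : ∀ G (X Y : Fin (V G) → Bool) →
  cutSize G (X ∩ Y) + cutSize G (X ∪ Y)
    + (edgeCount G (between (X ∖ Y) (Y ∖ X)) + edgeCount G (between (X ∖ Y) (Y ∖ X)))
  ≡ cutSize G X + cutSize G Y
cut-∩-∪ G X Y = cuts-identity G (X ∩ Y) (X ∪ Y) X Y (between (X ∖ Y) (Y ∖ X)) (λ xy → proj₁ (uncross-edge X Y xy))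

cut-∖-∖ : ∀ G (X Y : Fin (V G) → Bool) →
  cutSize G (X ∖ Y) + cutSize G (Y ∖ X)
    + (edgeCount G (between (X ∩ Y) (∁ (X ∪ Y))) + edgeCount G (between (X ∩ Y) (∁ (X ∪ Y))))
  ≡ cutSize G X + cutSize G Y
cut-∖-∖ G X Y = cuts-identity G (X ∖ Y) (Y ∖ X) X Y (between (X ∩ Y) (∁ (X ∪ Y))) (λ xy → proj₂ (uncross-edge X Y xy))

∩-⊕-∖ : ∀ x y → (x ∧ y) xor (x ∧ not y) ≡ x
∩-⊕-∖ true  true  = refl
∩-⊕-∖ true  false = refl
∩-⊕-∖ false _     = refl

-- If δ(X∩Y) is odd, submodularity squeezes it to 5;
-- if it is even, δ(X∖Y) and δ(Y∖X) are odd and posimodularity has no room for the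
-- edge from v to that neighbour.
tight-∩ : ∀ G → FiveOddConnected G → ∀ {v X Y} → Tight G v X → Tight G v Y →
  (a : HalfEdge G v) → X (nbr G a) ≡ false → Y (nbr G a) ≡ false → Tight G v (X ∩ Y)
tight-∩ G oc {v} {X} {Y} (Xv , cX) (Yv , cY) a Xu Yu = cong₂ _∧_ Xv Yv , cut-∩≡5
  where
  open ≡-Reasoning
  odd-bound : ∀ Z → parity (cutSize G Z) ≡ true → 5 ≤ cutSize G Z
  odd-bound Z p = oc Z (parity⇒odd (cutSize G Z) p)

  e₁ = edgeCount G (between (X ∖ Y) (Y ∖ X))
  e₂ = edgeCount G (between (X ∩ Y) (∁ (X ∪ Y)))

  submodular : cutSize G (X ∩ Y) + cutSize G (X ∪ Y) + (e₁ + e₁) ≡ 5 + 5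
  submodular = trans (cut-∩-∪ G X Y) (cong₂ _+_ cX cY)
  posimodular : cutSize G (X ∖ Y) + cutSize G (Y ∖ X) + (e₂ + e₂) ≡ 5 + 5
  posimodular = trans (cut-∖-∖ G X Y) (cong₂ _+_ cX cY)

  edge-at-v : 1 ≤ e₂
  edge-at-v = ≤-trans (≤-reflexive (cong 𝟙 (sym at-a))) (term≤sum _ (edgeOf G a))
    where
    at-a : between (X ∩ Y) (∁ (X ∪ Y)) (lookup (E G) (edgeOf G a)) ≡ true
    at-a = between-halfEdge G (X ∩ Y) (∁ (X ∪ Y)) a (cong₂ _∧_ Xv Yv) (cong not (cong₂ _∨_ Xu Yu))

  parity-X∖Y : parity (cutSize G (X ∩ Y)) ≡ false → parity (cutSize G (X ∖ Y)) ≡ true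
  parity-X∖Y even = begin
    parity (cutSize G (X ∖ Y))                                ≡⟨ cong (_xor parity (cutSize G (X ∖ Y))) (sym even) ⟩
    parity (cutSize G (X ∩ Y)) xor parity (cutSize G (X ∖ Y)) ≡⟨ sym (cut-parity G (X ∩ Y) (X ∖ Y)) ⟩
    parity (cutSize G ((X ∩ Y) ⊕ (X ∖ Y)))                    ≡⟨ cong parity (cut-cong G (λ z → ∩-⊕-∖ (X z) (Y z))) ⟩
    parity (cutSize G X)                                      ≡⟨ cong parity cX ⟩
    true                                                      ∎

  cut-∩≡5 : cutSize G (X ∩ Y) ≡ 5
  cut-∩≡5 with parity (cutSize G (X ∩ Y)) in parity-∩
  ... | true  = squeeze {k = e₁} (odd-bound (X ∩ Y) parity-∩)
                        (odd-bound (X ∪ Y) (trans (sym (same-parity (cutSize G (X ∩ Y)) (cutSize G (X ∪ Y)) e₁ 5 submodular)) parity-∩))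
                        submodular
  ... | false = ⊥-elim (overfull {k = e₂} (odd-bound (X ∖ Y) odd-X∖Y)
                                 (odd-bound (Y ∖ X) (trans (sym (same-parity (cutSize G (X ∖ Y)) (cutSize G (Y ∖ X)) e₂ 5 posimodular)) odd-X∖Y))
                                 edge-at-v posimodular)
    where odd-X∖Y = parity-X∖Y parity-∩

combine : ∀ G → FiveOddConnected G → ∀ {v} k (a : Fin (suc (suc k)) → HalfEdge G v) →
  (∀ i → Obstruction G v (nbr G (a (inject₁ i))) (nbr G (a (suc i)))) →
  Σ (Fin (V G) → Bool) λ Z → Tight G v Z × (∀ j → Z (nbr G (a j)) ≡ false)
combine G oc zero a obstructions with obstructions zero
... | X , tight , X₀ , X₁ = X , tight , λ { zero → X₀ ; (suc zero) → X₁ }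
combine G oc (suc k) a obstructions
  with obstructions zero | combine G oc k (a ∘ suc) (obstructions ∘ suc)
... | X , tight-X , X₀ , X₁ | Z , tight-Z , Z-avoids =
  X ∩ Z , tight-∩ G oc tight-X tight-Z (a (suc zero)) X₁ (Z-avoids zero) , avoids
  where
  avoids : ∀ j → (X ∩ Z) (nbr G (a j)) ≡ false
  avoids zero    = cong (_∧ Z (nbr G (a zero))) X₀
  avoids (suc j) = trans (cong (X (nbr G (a (suc j))) ∧_) (Z-avoids j)) (∧-zeroʳ _)

-- A set containing v but none of the other ends of m distinct half-edges at v has at
-- least m boundary edges (distinct half-edges on one edge would form a loop at v).
boundary-≥ : ∀ G {v m} (a : Fin m → HalfEdge G v) → Injective _≡_ _≡_ a →
  ∀ {Z} → Z v ≡ true → (∀ j → Z (nbr G (a j)) ≡ false) → m ≤ cutSize G Z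
boundary-≥ G {v} {m} a a-inj {Z} Zv avoids =
  subst (m ≤_) (sym (cut-as-sum G Z)) (sum-≥-injective (boundary G Z) (edgeOf G ∘ a) edges-distinct crossing)
  where
  edges-distinct : Injective _≡_ _≡_ (edgeOf G ∘ a)
  edges-distinct {i} {j} same with same-edge G (a i) (a j) same
  ... | inj₁ aᵢ≡aⱼ = a-inj aᵢ≡aⱼ
  ... | inj₂ uᵢ≡v with trans (sym Zv) (trans (cong Z (sym uᵢ≡v)) (avoids i))
  ...   | ()
  crossing : ∀ j → 1 ≤ boundary G Z (edgeOf G (a j))
  crossing j = ≤-reflexive (sym (trans (boundary-halfEdge G Z (a j))
                                       (cong₂ (λ p q → 𝟙 (p xor q)) Zv (avoids j))))

some-or-all : ∀ {n} {P Q : Fin n → Set} → (∀ i → P i ⊎ Q i) → (∃ P) ⊎ (∀ i → Q i)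
some-or-all {zero}  _ = inj₂ λ ()
some-or-all {suc n} decide with decide zero | some-or-all (decide ∘ suc)
... | inj₁ p | _            = inj₁ (zero , p)
... | inj₂ _ | inj₁ (i , p) = inj₁ (suc i , p)
... | inj₂ q | inj₂ qs      = inj₂ λ { zero → q ; (suc i) → qs i }

inject₁≢suc : ∀ {n} (i : Fin n) → inject₁ i ≢ suc i
inject₁≢suc i eq = 1+n≢n (sym (trans (sym (toℕ-inject₁ i)) (cong toℕ eq)))

some-splitting-works : ∀ G → FiveOddConnected G → ∀ {v} (a : Fin 6 → HalfEdge G v) →
  Injective _≡_ _≡_ a → ∃ λ (i : Fin 5) → FiveOddConnected (split G v (a (inject₁ i)) (a (suc i)))
some-splitting-works G oc {v} a a-inj
  with some-or-all (λ i → split-or-obstruction G oc v (a (inject₁ i)) (a (suc i))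
                            (λ eq → inject₁≢suc i (a-inj eq)))
... | inj₁ works = works
... | inj₂ obstructions with combine G oc 4 a obstructions
...   | Z , (Zv , cut≡5) , avoids =
  ⊥-elim (<-irrefl refl (subst (6 ≤_) cut≡5 (boundary-≥ G a a-inj Zv avoids)))

enumeration-injective : ∀ {d} (d≥6 : 6 ≤ d) {X : Set} (h : Fin d ⤖ X) →
  Injective _≡_ _≡_ (Bijection.to h ∘ idx d≥6)
enumeration-injective d≥6 h {i} {j} eq =
  toℕ-injective (fromℕ<-injective (toℕ i) (toℕ j) _ _ (Bijection.injective h eq))

lemma7 : (G : Graph) → FiveOddConnected G →
    (v : Fin (V G)) (d : ℕ) (d≥6 : 6 ≤ d) →
    (h : Fin d ⤖ HalfEdge G v) →
    ∃ λ (i : Fin 5) →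
    FiveOddConnected
    (split G v (Bijection.to h (idx d≥6 (inject₁ i))) (Bijection.to h (idx d≥6 (suc i))))
lemma7 G oc v d d≥6 h = some-splitting-works G oc (Bijection.to h ∘ idx d≥6) (enumeration-injective d≥6 h)
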